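{- Let $G=(V,A)$ be a flow graph with start vertex $s$, let $T$ be a rooted tree with the parent property, and let $G'=(V,A')$ be the derived graph of $G$ with respect to $T$. Suppose $T$ has the sibling property in $G$. Then for every $v\neq s$, either $(t(v),v)\in A$ (and then also $(t(v),v)\in A'$), or $v$ has in-degree at least two in $G'$.
   Context: A flow graph is a finite directed graph $G=(V,A)$ with start vertex $s$ such that every vertex is reachable from $s$; there are no arcs entering $s$. A vertex $v$ dominates $w$ if every path from $s$ to $w$ contains $v$. For a rooted tree $T$ with vertex set contained in $V$, $t(v)$ denotes the parent of $v$; ancestors and descendants include the vertex itself. $T$ has the parent property if for every arc $(v,w)\in A$, $t(w)$ is an ancestor of $v$ in $T$. $T$ has the sibling property if for all siblings $v,w$ in $T$, $v$ does not dominate $w$. For an arc $(v,w)\in A$, its derived arc is null if $w$ is an ancestor of $v$ in $T$, and otherwise is $(v',w)$, where $v'=v$ if $v=t(w)$, and otherwise $v'$ is the sibling of $w$ in $T$ that is an ancestor of $v$. The derived graph $G'$ has vertex set $V$ and arc set $A'$ consisting of all non-null derived arcs of arcs in $A$. -}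

module Defs where

open import Data.Nat using (ℕ)
open import Data.Fin using (Fin)
open import Data.Bool using (Bool; true)
open import Data.Product using (Σ; ∃; _×_; _,_)
open import Data.Sum using (_⊎_)
open import Relation.Nullary using (¬_)
open import Relation.Binary.PropositionalEquality using (_≡_; _≢_)

Graph : ℕ → Set
Graph n = Fin n → Fin n → Bool

Arc : ∀ {n} → Graph n → Fin n → Fin n → Set
Arc A u v = A u v ≡ true

-- Walks (paths in the sense of the paper: vertices may repeat) from x to y.
data Walk {n} (A : Graph n) : Fin n → Fin n → Set where
  []  : ∀ {x} → Walk A x x
  _∷_ : ∀ {x y z} → Arc A x y → Walk A y z → Walk A x z

data OnWalk {n} {A : Graph n} (u : Fin n) : ∀ {x y} → Walk A x y → Set where
  start-end : OnWalk u ([] {x = u})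
  start     : ∀ {y z} (e : Arc A u y) (p : Walk A y z) → OnWalk u (e ∷ p)
  later     : ∀ {x y z} (e : Arc A x y) {p : Walk A y z} → OnWalk u p → OnWalk u (e ∷ p)

record IsFlowGraph {n} (A : Graph n) (s : Fin n) : Set where
  field
    reachable : ∀ v → Walk A s v
    no-entry  : ∀ v → ¬ Arc A v s

Dominates : ∀ {n} → Graph n → Fin n → Fin n → Fin n → Set
Dominates A s v w = ∀ (p : Walk A s w) → OnWalk v p

-- A rooted tree on V with root s, given by a parent function t
-- (the value t s is irrelevant).
data Ancestor {n} (s : Fin n) (t : Fin n → Fin n) (u : Fin n) : Fin n → Set where
  here : Ancestor s t u u
  step : ∀ {v} → v ≢ s → Ancestor s t u (t v) → Ancestor s t u v

IsRootedTree : ∀ {n} → Fin n → (Fin n → Fin n) → Set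
IsRootedTree {n} s t = ∀ (v : Fin n) → Ancestor s t s v

ParentProperty : ∀ {n} → Graph n → Fin n → (Fin n → Fin n) → Set
ParentProperty A s t = ∀ v w → Arc A v w → Ancestor s t (t w) v

Siblings : ∀ {n} → Fin n → (Fin n → Fin n) → Fin n → Fin n → Set
Siblings s t v w = v ≢ w × v ≢ s × w ≢ s × t v ≡ t w

SiblingProperty : ∀ {n} → Graph n → Fin n → (Fin n → Fin n) → Set
SiblingProperty A s t = ∀ v w → Siblings s t v w → ¬ Dominates A s v w

-- (x , w) is the (non-null) derived arc of the arc (v , w).
IsDerivedArc : ∀ {n} → Graph n → Fin n → (Fin n → Fin n) → Fin n → Fin n → Fin n → Set
IsDerivedArc A s t v x w =
  Arc A v w × ¬ Ancestor s t w v ×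
  ((v ≡ t w × x ≡ v) ⊎ (v ≢ t w × Siblings s t x w × Ancestor s t x v))

DerivedArc : ∀ {n} → Graph n → Fin n → (Fin n → Fin n) → Fin n → Fin n → Set
DerivedArc A s t x w = ∃ λ v → IsDerivedArc A s t v x w

module Submission where

-- If (t v, v) is an arc it is its own derived arc, since v is not
-- an ancestor of its parent.  Otherwise every arc (u, v) has u ≠ t(v), and an
-- arc whose tail u is not a descendant of v derives to (x, v) where x is the
-- sibling of v that is an ancestor of u.  A walk from s to v must enter the
-- subtree of v, and by the parent property it can only do so by an arc into v
-- itself; so such "entry arcs" exist.  Fix one, deriving to (x₁, v).  If some
-- other entry arc has a tail outside the subtree of x₁, its derived arc has a
-- different tail and v has in-degree two in G'.  If not, every walk from s to
-- v reaches the subtree of x₁ before entering v, and hence (parent property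
-- again) passes through x₁ itself: the sibling x₁ dominates v, contradicting
-- the sibling property.

open import Defs
open import Data.Fin using (Fin; _≟_)
open import Data.Fin.Properties using (any?)
open import Data.Bool using (true; false)
import Data.Bool.Properties as Bool
open import Data.Product using (∃; _×_; _,_)
open import Data.Sum using (_⊎_; inj₁; inj₂)
open import Data.Empty using (⊥-elim)
open import Relation.Nullary using (¬_; Dec; yes; no)
open import Relation.Nullary.Decidable using (_×-dec_; ¬?)
open import Relation.Binary.PropositionalEquality using (_≡_; _≢_; refl; trans; sym)

module AncestorFacts {n} (s : Fin n) (t : Fin n → Fin n) where

  anc-trans : ∀ {u v w} → Ancestor s t u v → Ancestor s t v w → Ancestor s t u w
  anc-trans p here        = p
  anc-trans p (step ne q) = step ne (anc-trans p q)

  anc-root : ∀ {u} → Ancestor s t u s → u ≡ s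
  anc-root here        = refl
  anc-root (step ne _) = ⊥-elim (ne refl)

  anc-parent : ∀ {y b} → Ancestor s t y b → b ≢ y → Ancestor s t y (t b)
  anc-parent here       b≢y = ⊥-elim (b≢y refl)
  anc-parent (step _ q) _   = q

  anc-dec : ∀ u {v} → Ancestor s t s v → Dec (Ancestor s t u v)
  anc-dec u {v} r with u ≟ v
  ... | yes refl = yes here
  anc-dec u here         | no u≢v = no λ a → u≢v (anc-root a)
  anc-dec u (step v≢s r) | no u≢v with anc-dec u r
  ... | yes a = yes (step v≢s a)
  ... | no na = no λ { here → u≢v refl ; (step _ q) → na q }

  child-toward : ∀ {w u} → Ancestor s t w u → u ≢ w →
                 ∃ λ x → t x ≡ w × x ≢ s × Ancestor s t x u
  child-toward here            u≢w = ⊥-elim (u≢w refl)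
  child-toward {w} {u} (step u≢s q) u≢w with t u ≟ w
  ... | yes tu≡w = u , tu≡w , u≢s , here
  ... | no tu≢w with child-toward q tu≢w
  ...   | x , tx≡w , x≢s , xu = x , tx≡w , x≢s , step u≢s xu

  -- In a rooted tree no vertex is an ancestor of its own parent: a loop
  -- v ≼ t v would keep every descendant of v away from the root.
  no-cycle : IsRootedTree s t → ∀ v → v ≢ s → ¬ Ancestor s t v (t v)
  no-cycle rt v v≢s loop = unreachable (rt v) here
    where
      unreachable : ∀ {u} → Ancestor s t s u → ¬ Ancestor s t v u
      unreachable here         vs         = v≢s (anc-root vs)
      unreachable (step _ r)   here       = unreachable r loop
      unreachable (step _ r)   (step _ q) = unreachable r q

module ParentPropertyFacts {n} (A : Graph n) (s : Fin n) (t : Fin n → Fin n)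
                 (pp : ParentProperty A s t) where
  open AncestorFacts s t

  onWalk-start : ∀ {y z} (q : Walk A y z) → OnWalk y q
  onWalk-start []      = start-end
  onWalk-start (e ∷ q) = start e q

  -- Ancestors are unavoidable: a walk ending below y either meets y or
  -- starts below y.  (Each arc (a, b) has t b an ancestor of a.)
  ancestor-on-walk : ∀ {a z y} (p : Walk A a z) → Ancestor s t y z →
                     OnWalk y p ⊎ Ancestor s t y a
  ancestor-on-walk [] yz = inj₂ yz
  ancestor-on-walk {a} {y = y} (_∷_ {y = b} e q) yz with ancestor-on-walk q yz
  ... | inj₁ on = inj₁ (later e on)
  ... | inj₂ yb with b ≟ y
  ...   | yes refl = inj₁ (later e (onWalk-start q))
  ...   | no b≢y   = inj₂ (anc-trans (anc-parent yb b≢y) (pp a b e))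

  entry-arc : ∀ {a z v} (p : Walk A a z) → ¬ Ancestor s t v a → Ancestor s t v z →
              ∃ λ u → Arc A u v × ¬ Ancestor s t v u ×
                ∃ λ (q : Walk A a u) → ∀ y → OnWalk y q → OnWalk y p
  entry-arc [] va vz = ⊥-elim (va vz)
  entry-arc {a} {v = v} (_∷_ {y = b} e q) va vz with b ≟ v
  ... | yes refl = a , e , va , [] , λ { _ start-end → start e q }
  ... | no b≢v with entry-arc q (λ vb → va (anc-trans (anc-parent vb b≢v) (pp a b e))) vz
  ...   | u , uv , vu , q′ , q′⊆q = u , uv , vu , e ∷ q′ , prefix
    where
      prefix : ∀ y → OnWalk y (e ∷ q′) → OnWalk y (e ∷ q)
      prefix _ (start .e .q′) = start e q
      prefix y (later .e on)  = later e (q′⊆q y on)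

  dominates-if-entries-below : ∀ {x v} → x ≢ s → v ≢ s →
    (∀ u → Arc A u v → ¬ Ancestor s t v u → Ancestor s t x u) →
    Dominates A s x v
  dominates-if-entries-below x≢s v≢s below p
    with entry-arc p (λ vs → v≢s (anc-root vs)) here
  ... | u , uv , vu , q , q⊆p with ancestor-on-walk q (below u uv vu)
  ...   | inj₁ on = q⊆p _ on
  ...   | inj₂ xs = ⊥-elim (x≢s (anc-root xs))

  derived-via-sibling : ∀ {u v} → v ≢ s → Arc A u v → ¬ Ancestor s t v u → u ≢ t v →
    ∃ λ x → Siblings s t x v × Ancestor s t x u × IsDerivedArc A s t u x v
  derived-via-sibling {u} {v} v≢s uv vu u≢tv with child-toward (pp u v uv) u≢tv
  ... | x , tx≡tv , x≢s , xu =
    x , sib , xu , uv , vu , inj₂ (u≢tv , sib , xu)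
    where
      sib : Siblings s t x v
      sib = (λ { refl → vu xu }) , x≢s , v≢s , tx≡tv

module InDegreeTwo {n} (A : Graph n) (s : Fin n) (t : Fin n → Fin n)
                   (fg : IsFlowGraph A s) (rt : IsRootedTree s t)
                   (pp : ParentProperty A s t) (sp : SiblingProperty A s t) where
  open AncestorFacts s t
  open ParentPropertyFacts A s t pp

  entries-avoiding? : ∀ x v →
    (∃ λ u → Arc A u v × ¬ Ancestor s t v u × ¬ Ancestor s t x u)
    ⊎ (∀ u → Arc A u v → ¬ Ancestor s t v u → Ancestor s t x u)
  entries-avoiding? x v
    with any? (λ u → (A u v Bool.≟ true) ×-dec ¬? (anc-dec v (rt u)) ×-dec ¬? (anc-dec x (rt u)))
  ... | yes entry = inj₁ entry
  ... | no none   = inj₂ below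
    where
      below : ∀ u → Arc A u v → ¬ Ancestor s t v u → Ancestor s t x u
      below u uv vu with anc-dec x (rt u)
      ... | yes xu = xu
      ... | no x∤u = ⊥-elim (none (u , uv , vu , x∤u))

  -- Take one entry arc, deriving to (x₁, v); an entry arc outside the subtree
  -- of x₁ gives a second derived arc, and without one x₁ would dominate v.
  two-derived-arcs : ∀ v → v ≢ s → (∀ u → Arc A u v → u ≢ t v) →
    ∃ λ x₁ → ∃ λ x₂ → x₁ ≢ x₂ × DerivedArc A s t x₁ v × DerivedArc A s t x₂ v
  two-derived-arcs v v≢s not-parent
    with entry-arc (IsFlowGraph.reachable fg v) (λ vs → v≢s (anc-root vs)) here
  ... | u₁ , uv₁ , vu₁ , _
    with derived-via-sibling v≢s uv₁ vu₁ (not-parent u₁ uv₁)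
  ... | x₁ , sib₁@(_ , x₁≢s , _) , _ , der₁ with entries-avoiding? x₁ v
  ...   | inj₂ below =
    ⊥-elim (sp x₁ v sib₁ (dominates-if-entries-below x₁≢s v≢s below))
  ...   | inj₁ (u₂ , uv₂ , vu₂ , x₁∤u₂)
    with derived-via-sibling v≢s uv₂ vu₂ (not-parent u₂ uv₂)
  ...     | x₂ , _ , x₂u₂ , der₂ =
    x₁ , x₂ , (λ { refl → x₁∤u₂ x₂u₂ }) , (u₁ , der₁) , (u₂ , der₂)

lemma19 : ∀ {n} (A : Graph n) (s : Fin n) (t : Fin n → Fin n) →
    IsFlowGraph A s → IsRootedTree s t → ParentProperty A s t →
    SiblingProperty A s t →
    ∀ v → v ≢ s →
      (Arc A (t v) v × DerivedArc A s t (t v) v)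
      ⊎ (∃ λ u₁ → ∃ λ u₂ → u₁ ≢ u₂ × DerivedArc A s t u₁ v × DerivedArc A s t u₂ v)
lemma19 A s t fg rt pp sp v v≢s with A (t v) v in tv-arc
... | true  = inj₁ (refl , t v , tv-arc , AncestorFacts.no-cycle s t rt v v≢s , inj₁ (refl , refl))
... | false = inj₂ (InDegreeTwo.two-derived-arcs A s t fg rt pp sp v v≢s not-parent)
  where
    not-parent : ∀ u → Arc A u v → u ≢ t v
    not-parent u uv refl with trans (sym uv) tv-arc
    ... | ()
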